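{- Let $G$ and $G'$ be two graphs on the same finite set $V$ of $v$ vertices and let $k$ be an integer with $4\leq k\leq v$. If $G$ and $G'$ are $k$-hypomorphic up to complementation, then for every integer $l$ with $k\leq l\leq v$ and every $l$-element subset $L$ of $V$, $e(G'_{\restriction L})=e(G_{\restriction L})$ or $e(G'_{\restriction L})=e(\overline G_{\restriction L})$.
   Context: A graph is a pair $G=(V,E)$ with $E$ a set of 2-element subsets of $V$; $\overline G$ is its complement, $G_{\restriction K}$ the induced subgraph on $K$, and $e(H)$ the number of edges of $H$. Two graphs are isomorphic up to complementation if one is isomorphic to the other or to its complement; $G,G'$ on $V$ are $k$-hypomorphic up to complementation if $G_{\restriction K}$ and $G'_{\restriction K}$ are isomorphic up to complementation for every $k$-element $K\subseteq V$. -}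

module Defs where

open import Data.Nat using (ℕ; _<_)
open import Data.Bool using (Bool; true; false; not)
open import Data.Fin using (Fin; toℕ)
open import Data.Fin.Subset using (Subset; _∈_)
open import Data.Product using (Σ; _×_; proj₁)
open import Data.Sum using (_⊎_)
open import Data.List using (List; length; filter; allFin; cartesianProduct)
open import Function.Bundles using (_⤖_; Bijection)
open import Relation.Binary.PropositionalEquality using (_≡_)
open import Relation.Nullary using (¬_; Dec; yes; no)
open import Relation.Nullary.Decidable using (_×-dec_)
open import Data.Fin.Properties using () renaming (_<?_ to _<ᶠ?_)
open import Data.Fin.Subset.Properties using (_∈?_)
open import Data.Bool.Properties using (T?)
open import Data.Bool using (T)
import Data.Fin as F

-- A (simple, loopless, undirected) graph on the vertex set Fin v:
-- the adjacency predicate encodes the set E of 2-element subsets.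
record Graph (v : ℕ) : Set where
  field
    adj   : Fin v → Fin v → Bool
    sym   : ∀ x y → adj x y ≡ adj y x
    irrefl : ∀ x → adj x x ≡ false
open Graph public

complement : ∀ {v} → Graph v → Graph v
complement {v} G = record { adj = a ; sym = s ; irrefl = i }
  where
  open import Data.Fin.Properties using (_≟_)
  a : Fin v → Fin v → Bool
  a x y with x ≟ y
  ... | yes _ = false
  ... | no _ = not (adj G x y)
  s : ∀ x y → a x y ≡ a y x
  s x y with x ≟ y | y ≟ x
  ... | yes _ | yes _ = Relation.Binary.PropositionalEquality.refl
  ... | yes p | no q = Data.Empty.⊥-elim (q (Relation.Binary.PropositionalEquality.sym p))
    where import Data.Empty
  ... | no p | yes q = Data.Empty.⊥-elim (p (Relation.Binary.PropositionalEquality.sym q))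
    where import Data.Empty
  ... | no _ | no _ = Relation.Binary.PropositionalEquality.cong not (sym G x y)
  i : ∀ x → a x x ≡ false
  i x with x ≟ x
  ... | yes _ = Relation.Binary.PropositionalEquality.refl
  ... | no p = Data.Empty.⊥-elim (p Relation.Binary.PropositionalEquality.refl)
    where import Data.Empty

Elem : ∀ {v} → Subset v → Set
Elem {v} K = Σ (Fin v) (λ x → x ∈ K)

-- G↾K and H↾K are isomorphic: a bijection of K onto itself
-- preserving adjacency (both induced subgraphs have vertex set K).
IsoOn : ∀ {v} → Subset v → Graph v → Graph v → Set
IsoOn K G H =
  Σ (Elem K ⤖ Elem K) λ σ →
    ∀ x y → adj G (proj₁ x) (proj₁ y)
          ≡ adj H (proj₁ (Bijection.to σ x))
                  (proj₁ (Bijection.to σ y))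

IsoUpToCompOn : ∀ {v} → Subset v → Graph v → Graph v → Set
IsoUpToCompOn K G H = IsoOn K G H ⊎ IsoOn K G (complement H)

HypomorphicUpToComp : ∀ {v} → ℕ → Graph v → Graph v → Set
HypomorphicUpToComp {v} k G H =
  ∀ (K : Subset v) → Data.Fin.Subset.∣ K ∣ ≡ k → IsoUpToCompOn K G H
  where import Data.Fin.Subset

edges : ∀ {v} → Graph v → Subset v → ℕ
edges {v} G L = length (filter P? (cartesianProduct (allFin v) (allFin v)))
  where
  open import Data.Product using (_,_)
  P : Fin v × Fin v → Set
  P (x , y) = (x F.< y) × ((x ∈ L) × ((y ∈ L) × T (adj G x y)))
  P? : ∀ p → Dec (P p)
  P? (x , y) = (x <ᶠ? y) ×-dec ((x ∈? L) ×-dec ((y ∈? L) ×-dec T? (adj G x y)))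

-- Write d = A(G′) − A(G) and s = A(Ḡ) − A(G′) for the adjacency matrices, and for a vertex
-- set L put X = Σ_{x,y∈L} d, Y = Σ_{x,y∈L} s and Ψ = Σ_{x∈L} deg_d(x) deg_s(x), the degrees
-- being taken inside L.  Then X = 2(e(G′↾L) − e(G↾L)) and Y = 2(e(Ḡ↾L) − e(G′↾L)), so it
-- suffices that the invariant "XY = 0 and Ψ = 0" holds for every L with |L| ≥ k.
-- On k-sets, G′↾L ≅ G↾L gives X = 0 and, as G and G′ have the same degree sequence on L,
-- Ψ = 0; G′↾L ≅ Ḡ↾L is the same case with d and s exchanged.  For larger L, since d and s
-- are symmetric, hollow and never both nonzero at a pair, averaging over the deletions of
-- one point gives
--   Σ_z Ψ(L − z) = (|L| − 3) Ψ(L),   Σ_z X(L − z) Y(L − z) = (|L| − 4) X(L) Y(L) + 4 Ψ(L),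
-- so the invariant passes from the (|L| − 1)-subsets to L as soon as |L| ≥ 5.
module Submission where

open import Data.Bool using (Bool; true; false; _∧_)
open import Data.Empty using (⊥-elim)
open import Data.Fin using (Fin; zero; suc)
open import Data.Fin.Permutation using (Permutation′; permutation; _⟨$⟩ʳ_)
open import Data.Fin.Properties using (_≟_; <-cmp) renaming (_<?_ to _<ᶠ?_)
open import Data.Fin.Subset using (Subset; _∈_; _∉_; ∣_∣; inside; outside)
open import Data.Fin.Subset.Properties using (_∈?_)
open import Data.Integer using (ℤ; +_; _+_; _-_; _*_; -_; 0ℤ; 1ℤ; -1ℤ; _<_; +<+)
import Data.Integer.Properties as ℤ
open import Data.Integer.Tactic.RingSolver using (solve-∀)
open import Data.List using (length; filter; tabulate; map; _++_; cartesianProduct)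
open import Data.List.Properties using (filter-++; length-++; map-tabulate)
open import Data.Nat as ℕ using (ℕ; zero; suc; _≤_)
import Data.Nat.Properties as ℕ
open import Data.Product using (_×_; _,_; proj₁; proj₂)
open import Data.Sum as Sum using (_⊎_; [_,_]; inj₁; inj₂)
open import Data.Vec using (lookup; _∷_; []; _[_]≔_; here; there)
open import Data.Vec.Functional using (Vector)
open import Data.Vec.Properties using (lookup∘update; lookup∘update′; []=⇒lookup; lookup⇒[]=)
open import Data.Vec.Properties.WithK using ([]=-irrelevant)
open import Function using (_∘_; id)
open import Function.Bundles using (_⤖_; Bijection; Inverse)
open import Function.Properties.Bijection using (⤖⇒↔)
open import Level using (0ℓ)
open import Relation.Binary.Definitions using (tri<; tri≈; tri>)
open import Relation.Binary.PropositionalEquality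
  using (_≡_; _≢_; refl; sym; trans; cong; cong₂; subst; module ≡-Reasoning)
open import Relation.Nullary using (does; yes; no)
open import Relation.Nullary.Decidable using (dec-true; dec-false)
open import Relation.Unary using (Pred; Decidable)

open import Algebra.Properties.CommutativeSemigroup ℤ.*-commutativeSemigroup using (x∙yz≈y∙xz)
open import Algebra.Properties.Semiring.Sum ℤ.+-*-semiring
  using (sum; sum-cong-≗; sum-replicate-zero; ∑-distrib-+; ∑-comm; ∑-permute; *-distribˡ-sum)

open import Defs
  using (Graph; adj; irrefl; complement; Elem; IsoOn; IsoUpToCompOn; HypomorphicUpToComp; edges)

private variable
  n : ℕ

-- Weighted sums over Fin n

bit : Bool → ℤ
bit true = 1ℤ
bit false = 0ℤ

δ : Fin n → Fin n → ℤ
δ x y = bit (does (x ≟ y))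

infix 4 ⟨_,_⟩

⟨_,_⟩ : Vector ℤ n → Vector ℤ n → ℤ
⟨ w , F ⟩ = sum (λ x → w x * F x)

⟨,⟩-cong : (w : Vector ℤ n) {F G : Vector ℤ n} → (∀ x → F x ≡ G x) → ⟨ w , F ⟩ ≡ ⟨ w , G ⟩
⟨,⟩-cong w F≗G = sum-cong-≗ (λ x → cong (w x *_) (F≗G x))

⟨,⟩-comm : (w F : Vector ℤ n) → ⟨ w , F ⟩ ≡ ⟨ F , w ⟩
⟨,⟩-comm w F = sum-cong-≗ (λ x → ℤ.*-comm (w x) (F x))

⟨,⟩-zero : (w : Vector ℤ n) {F : Vector ℤ n} → (∀ x → w x * F x ≡ 0ℤ) → ⟨ w , F ⟩ ≡ 0ℤ
⟨,⟩-zero {n} w wF≡0 = trans (sum-cong-≗ wF≡0) (sum-replicate-zero n)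

⟨,⟩-+ : (w F G : Vector ℤ n) → ⟨ w , (λ x → F x + G x) ⟩ ≡ ⟨ w , F ⟩ + ⟨ w , G ⟩
⟨,⟩-+ {n} w F G =
  trans (sum-cong-≗ {n} (λ x → ℤ.*-distribˡ-+ (w x) (F x) (G x))) (∑-distrib-+ {n} _ _)

⟨,⟩-* : (c : ℤ) (w F : Vector ℤ n) → ⟨ w , (λ x → c * F x) ⟩ ≡ c * ⟨ w , F ⟩
⟨,⟩-* {n} c w F =
  trans (sum-cong-≗ {n} (λ x → x∙yz≈y∙xz (w x) c (F x))) (sym (*-distribˡ-sum {n} c _))

⟨,⟩-- : (w F G : Vector ℤ n) → ⟨ w , (λ x → F x - G x) ⟩ ≡ ⟨ w , F ⟩ - ⟨ w , G ⟩
⟨,⟩-- w F G = begin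
  ⟨ w , (λ x → F x - G x) ⟩             ≡⟨ ⟨,⟩-+ w F (λ x → - G x) ⟩
  ⟨ w , F ⟩ + ⟨ w , (λ x → - G x) ⟩     ≡⟨ cong (_+_ ⟨ w , F ⟩) negate ⟩
  ⟨ w , F ⟩ - ⟨ w , G ⟩                 ∎
  where
  open ≡-Reasoning
  negate : ⟨ w , (λ x → - G x) ⟩ ≡ - ⟨ w , G ⟩
  negate = trans (⟨,⟩-cong w (λ x → sym (ℤ.-1*i≡-i (G x))))
                 (trans (⟨,⟩-* -1ℤ w G) (ℤ.-1*i≡-i _))

⟨,⟩-const : (c : ℤ) (w : Vector ℤ n) → ⟨ w , (λ _ → c) ⟩ ≡ c * sum w
⟨,⟩-const c w = trans (⟨,⟩-comm w (λ _ → c)) (sym (*-distribˡ-sum c w))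

⟨1,⟩ : (F : Vector ℤ n) → ⟨ (λ _ → 1ℤ) , F ⟩ ≡ sum F
⟨1,⟩ {n} F = sum-cong-≗ {n} (λ x → ℤ.*-identityˡ (F x))

⟨,⟩-permute : (w F : Vector ℤ n) (π : Permutation′ n) → (∀ x → w (π ⟨$⟩ʳ x) ≡ w x) →
              ⟨ w , F ⟩ ≡ ⟨ w , F ∘ (π ⟨$⟩ʳ_) ⟩
⟨,⟩-permute {n} w F π w∘π≗w =
  trans (∑-permute (λ x → w x * F x) π) (sum-cong-≗ {n} (λ x → cong (_* F (π ⟨$⟩ʳ x)) (w∘π≗w x)))

⟨,⟩-swap : (w : Vector ℤ n) (g : Fin n → Fin n → ℤ) →
           ⟨ w , (λ z → ⟨ w , (λ x → g x z) ⟩) ⟩ ≡ ⟨ w , (λ x → ⟨ w , g x ⟩) ⟩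
⟨,⟩-swap {n} w g = begin
  sum (λ z → w z * sum (λ x → w x * g x z))
    ≡⟨ sum-cong-≗ {n} (λ z → *-distribˡ-sum {n} (w z) _) ⟩
  sum (λ z → sum (λ x → w z * (w x * g x z)))
    ≡⟨ ∑-comm {n} {n} _ ⟨
  sum (λ x → sum (λ z → w z * (w x * g x z)))
    ≡⟨ sum-cong-≗ {n} (λ x → sum-cong-≗ {n} (λ z → x∙yz≈y∙xz (w z) (w x) (g x z))) ⟩
  sum (λ x → sum (λ z → w x * (w z * g x z)))
    ≡⟨ sum-cong-≗ {n} (λ x → *-distribˡ-sum {n} (w x) _) ⟨
  sum (λ x → w x * sum (λ z → w z * g x z))
    ∎
  where open ≡-Reasoning

⟨δ,⟩ : (z : Fin n) (F : Vector ℤ n) → ⟨ δ z , F ⟩ ≡ F z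
⟨δ,⟩ {suc n} zero F =
  trans (cong₂ _+_ (ℤ.*-identityˡ (F zero)) (⟨,⟩-zero (δ zero ∘ suc) {F ∘ suc} (λ _ → refl)))
        (ℤ.+-identityʳ (F zero))
⟨δ,⟩ (suc z) F = trans (ℤ.+-identityˡ _) (⟨δ,⟩ z (F ∘ suc))

-- Deleting one point from a weight

Matrix : ℕ → Set
Matrix n = Fin n → Fin n → ℤ

Symmetric : Matrix n → Set
Symmetric f = ∀ x y → f x y ≡ f y x

Hollow : Matrix n → Set
Hollow f = ∀ x → f x x ≡ 0ℤ

deg : Matrix n → Vector ℤ n → Vector ℤ n
deg f w x = ⟨ w , f x ⟩

total : Matrix n → Vector ℤ n → ℤ
total f w = ⟨ w , deg f w ⟩

cross : Matrix n → Matrix n → Vector ℤ n → ℤ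
cross d s w = ⟨ w , (λ x → deg d w x * deg s w x) ⟩

infixl 6 _∖_

_∖_ : Vector ℤ n → Fin n → Vector ℤ n
(w ∖ z) x = w x - δ z x

⟨∖,⟩ : (w : Vector ℤ n) (z : Fin n) (F : Vector ℤ n) → ⟨ w ∖ z , F ⟩ ≡ ⟨ w , F ⟩ - F z
⟨∖,⟩ w z F = begin
  ⟨ w ∖ z , F ⟩             ≡⟨ ⟨,⟩-comm (w ∖ z) F ⟩
  ⟨ F , w ∖ z ⟩             ≡⟨ ⟨,⟩-- F w (δ z) ⟩
  ⟨ F , w ⟩ - ⟨ F , δ z ⟩
    ≡⟨ cong₂ _-_ (⟨,⟩-comm F w) (trans (⟨,⟩-comm F (δ z)) (⟨δ,⟩ z F)) ⟩
  ⟨ w , F ⟩ - F z           ∎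
  where open ≡-Reasoning

deg-∖ : (f : Matrix n) (w : Vector ℤ n) (z x : Fin n) → deg f (w ∖ z) x ≡ deg f w x - f x z
deg-∖ f w z x = ⟨∖,⟩ w z (f x)

total-∖ : {f : Matrix n} → Symmetric f → Hollow f → (w : Vector ℤ n) (z : Fin n) →
          total f (w ∖ z) ≡ total f w - + 2 * deg f w z
total-∖ {f = f} f-sym f-hollow w z = begin
  ⟨ w ∖ z , deg f (w ∖ z) ⟩                        ≡⟨ ⟨,⟩-cong (w ∖ z) (deg-∖ f w z) ⟩
  ⟨ w ∖ z , (λ x → D x - f x z) ⟩                  ≡⟨ ⟨∖,⟩ w z _ ⟩
  ⟨ w , (λ x → D x - f x z) ⟩ - (D z - f z z)
    ≡⟨ cong₂ _-_ (⟨,⟩-- w D (λ x → f x z)) (cong (_-_ (D z)) (f-hollow z)) ⟩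
  total f w - ⟨ w , (λ x → f x z) ⟩ - (D z - 0ℤ)
    ≡⟨ cong (λ t → total f w - t - (D z - 0ℤ)) (⟨,⟩-cong w (λ x → f-sym x z)) ⟩
  total f w - D z - (D z - 0ℤ)                     ≡⟨ collect (total f w) (D z) ⟩
  total f w - + 2 * D z                            ∎
  where
  open ≡-Reasoning
  D = deg f w
  collect : ∀ t a → t - a - (a - 0ℤ) ≡ t - + 2 * a
  collect = solve-∀

⟨,⟩-total*total-∖ : {d s : Matrix n} → Symmetric d → Hollow d → Symmetric s → Hollow s →
                    (w : Vector ℤ n) →
                    ⟨ w , (λ z → total d (w ∖ z) * total s (w ∖ z)) ⟩
                      ≡ (sum w - + 4) * (total d w * total s w) + + 4 * cross d s w
⟨,⟩-total*total-∖ {d = d} {s} d-sym d-hollow s-sym s-hollow w = begin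
  ⟨ w , (λ z → total d (w ∖ z) * total s (w ∖ z)) ⟩
    ≡⟨ ⟨,⟩-cong w (λ z → cong₂ _*_ (total-∖ d-sym d-hollow w z) (total-∖ s-sym s-hollow w z)) ⟩
  ⟨ w , (λ z → (X - + 2 * D z) * (Y - + 2 * S z)) ⟩
    ≡⟨ ⟨,⟩-cong w (λ z → expand X Y (D z) (S z)) ⟩
  ⟨ w , (λ z → (X * Y + + 4 * (D z * S z)) - + 2 * (Y * D z + X * S z)) ⟩
    ≡⟨ trans (⟨,⟩-- w _ _) (cong₂ _-_ (⟨,⟩-+ w _ _) (⟨,⟩-* (+ 2) w _)) ⟩
  (⟨ w , (λ _ → X * Y) ⟩ + ⟨ w , (λ z → + 4 * (D z * S z)) ⟩)
    - + 2 * ⟨ w , (λ z → Y * D z + X * S z) ⟩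
    ≡⟨ cong₂ (λ a b → a - + 2 * b) (cong₂ _+_ (⟨,⟩-const (X * Y) w) (⟨,⟩-* (+ 4) w _))
                                    (trans (⟨,⟩-+ w _ _) (cong₂ _+_ (⟨,⟩-* Y w D) (⟨,⟩-* X w S))) ⟩
  (X * Y * sum w + + 4 * cross d s w) - + 2 * (Y * X + X * Y)
    ≡⟨ collect X Y (sum w) (cross d s w) ⟩
  (sum w - + 4) * (X * Y) + + 4 * cross d s w
    ∎
  where
  open ≡-Reasoning
  D = deg d w
  S = deg s w
  X = total d w
  Y = total s w
  expand : ∀ X Y a b → (X - + 2 * a) * (Y - + 2 * b) ≡ (X * Y + + 4 * (a * b)) - + 2 * (Y * a + X * b)
  expand = solve-∀
  collect : ∀ X Y N P → (X * Y * N + + 4 * P) - + 2 * (Y * X + X * Y) ≡ (N - + 4) * (X * Y) + + 4 * P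
  collect = solve-∀

cross-∖ : {d s : Matrix n} → Hollow d → Hollow s → (w : Vector ℤ n) (z : Fin n) →
          (∀ x → d x z * s x z ≡ 0ℤ) →
          cross d s (w ∖ z)
            ≡ ⟨ w , (λ x → deg d w x * deg s w x - deg d w x * s x z - d x z * deg s w x) ⟩
              - deg d w z * deg s w z
cross-∖ {d = d} {s} d-hollow s-hollow w z ds≡0 = begin
  ⟨ w ∖ z , (λ x → deg d (w ∖ z) x * deg s (w ∖ z) x) ⟩
    ≡⟨ ⟨,⟩-cong (w ∖ z) (λ x → cong₂ _*_ (deg-∖ d w z x) (deg-∖ s w z x)) ⟩
  ⟨ w ∖ z , (λ x → (D x - d x z) * (S x - s x z)) ⟩
    ≡⟨ ⟨∖,⟩ w z _ ⟩
  ⟨ w , (λ x → (D x - d x z) * (S x - s x z)) ⟩ - (D z - d z z) * (S z - s z z)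
    ≡⟨ cong₂ _-_ (⟨,⟩-cong w (λ x → expand (D x) (d x z) (S x) (s x z) (ds≡0 x)))
                 (cong₂ (λ a b → (D z - a) * (S z - b)) (d-hollow z) (s-hollow z)) ⟩
  ⟨ w , (λ x → D x * S x - D x * s x z - d x z * S x) ⟩ - (D z - 0ℤ) * (S z - 0ℤ)
    ≡⟨ cong (_-_ ⟨ w , (λ x → D x * S x - D x * s x z - d x z * S x) ⟩)
            (cong₂ _*_ (ℤ.+-identityʳ (D z)) (ℤ.+-identityʳ (S z))) ⟩
  ⟨ w , (λ x → D x * S x - D x * s x z - d x z * S x) ⟩ - D z * S z
    ∎
  where
  open ≡-Reasoning
  D = deg d w
  S = deg s w
  expand : ∀ a p b q → p * q ≡ 0ℤ → (a - p) * (b - q) ≡ a * b - a * q - p * b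
  expand a p b q pq≡0 =
    trans (distribute a p b q) (trans (cong (λ t → a * b - a * q - p * b + t) pq≡0) (ℤ.+-identityʳ _))
    where
    distribute : ∀ a p b q → (a - p) * (b - q) ≡ a * b - a * q - p * b + p * q
    distribute = solve-∀

⟨,⟩-cross-∖ : {d s : Matrix n} → Hollow d → Hollow s → (∀ x y → d x y * s x y ≡ 0ℤ) →
              (w : Vector ℤ n) → ⟨ w , (λ z → cross d s (w ∖ z)) ⟩ ≡ (sum w - + 3) * cross d s w
⟨,⟩-cross-∖ {n} {d} {s} d-hollow s-hollow ds≡0 w = begin
  ⟨ w , (λ z → cross d s (w ∖ z)) ⟩
    ≡⟨ ⟨,⟩-cong w (λ z → cross-∖ d-hollow s-hollow w z (λ x → ds≡0 x z)) ⟩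
  ⟨ w , (λ z → ⟨ w , (λ x → Q x z) ⟩ - D z * S z) ⟩
    ≡⟨ ⟨,⟩-- w _ _ ⟩
  ⟨ w , (λ z → ⟨ w , (λ x → Q x z) ⟩) ⟩ - cross d s w
    ≡⟨ cong (λ t → t - cross d s w) (⟨,⟩-swap w Q) ⟩
  ⟨ w , (λ x → ⟨ w , Q x ⟩) ⟩ - cross d s w
    ≡⟨ cong (λ t → t - cross d s w) (trans (⟨,⟩-cong w inner) (⟨,⟩-* (sum w - + 2) w _)) ⟩
  (sum w - + 2) * cross d s w - cross d s w
    ≡⟨ collect (sum w) (cross d s w) ⟩
  (sum w - + 3) * cross d s w
    ∎
  where
  open ≡-Reasoning
  D = deg d w
  S = deg s w
  Q : Matrix n
  Q x z = D x * S x - D x * s x z - d x z * S x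
  inner : ∀ x → ⟨ w , Q x ⟩ ≡ (sum w - + 2) * (D x * S x)
  inner x = begin
    ⟨ w , Q x ⟩
      ≡⟨ trans (⟨,⟩-- w _ _) (cong (λ t → t - ⟨ w , (λ z → d x z * S x) ⟩) (⟨,⟩-- w _ _)) ⟩
    ⟨ w , (λ _ → D x * S x) ⟩ - ⟨ w , (λ z → D x * s x z) ⟩ - ⟨ w , (λ z → d x z * S x) ⟩
      ≡⟨ cong₂ _-_ (cong₂ _-_ (⟨,⟩-const (D x * S x) w) (⟨,⟩-* (D x) w (s x)))
                   (trans (⟨,⟩-cong w (λ z → ℤ.*-comm (d x z) (S x))) (⟨,⟩-* (S x) w (d x))) ⟩
    D x * S x * sum w - D x * S x - S x * D x
      ≡⟨ factor (D x) (S x) (sum w) ⟩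
    (sum w - + 2) * (D x * S x)
      ∎
    where
    factor : ∀ a b N → a * b * N - a * b - b * a ≡ (N - + 2) * (a * b)
    factor = solve-∀
  collect : ∀ N P → (N - + 2) * P - P ≡ (N - + 3) * P
  collect = solve-∀

-- The balance invariant

record Balanced (d s : Matrix n) (w : Vector ℤ n) : Set where
  constructor balanced
  field
    product≡0 : total d w * total s w ≡ 0ℤ
    cross≡0   : cross d s w ≡ 0ℤ

module _ {d d′ s s′ : Matrix n}
         (d≗d′ : ∀ x y → d x y ≡ d′ x y) (s≗s′ : ∀ x y → s x y ≡ s′ x y)
         {w w′ : Vector ℤ n} (w≗w′ : ∀ x → w x ≡ w′ x) where

  private
    deg-cong : {f f′ : Matrix n} → (∀ x y → f x y ≡ f′ x y) → ∀ x → deg f w x ≡ deg f′ w′ x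
    deg-cong f≗f′ x = sum-cong-≗ {n} (λ y → cong₂ _*_ (w≗w′ y) (f≗f′ x y))

    total-cong : {f f′ : Matrix n} → (∀ x y → f x y ≡ f′ x y) → total f w ≡ total f′ w′
    total-cong f≗f′ = sum-cong-≗ {n} (λ x → cong₂ _*_ (w≗w′ x) (deg-cong f≗f′ x))

  Balanced-cong : Balanced d s w → Balanced d′ s′ w′
  Balanced-cong (balanced product≡0 cross≡0) = balanced
      (trans (sym (cong₂ _*_ (total-cong d≗d′) (total-cong s≗s′))) product≡0)
      (trans (sym (sum-cong-≗ {n} λ x →
                     cong₂ _*_ (w≗w′ x) (cong₂ _*_ (deg-cong d≗d′ x) (deg-cong s≗s′ x))))
             cross≡0)

Balanced-swap : {d s : Matrix n} {w : Vector ℤ n} → Balanced d s w → Balanced s d w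
Balanced-swap {d = d} {s} {w} (balanced product≡0 cross≡0) = balanced
  (trans (ℤ.*-comm (total s w) (total d w)) product≡0)
  (trans (⟨,⟩-cong w (λ x → ℤ.*-comm (deg s w x) (deg d w x))) cross≡0)

private
  *-cancel-≢0 : ∀ {a b} → a ≢ 0ℤ → a * b ≡ 0ℤ → b ≡ 0ℤ
  *-cancel-≢0 {a} a≢0 ab≡0 = [ (λ a≡0 → ⊥-elim (a≢0 a≡0)) , id ] (ℤ.i*j≡0⇒i≡0∨j≡0 a ab≡0)

  c<N⇒N-c≢0 : ∀ {c N} → + c < N → N - + c ≢ 0ℤ
  c<N⇒N-c≢0 c<N N-c≡0 = ℤ.<-irrefl (sym (ℤ.i-j≡0⇒i≡j _ _ N-c≡0)) c<N

balanced-from-deletions : {d s : Matrix n} → Symmetric d → Hollow d → Symmetric s → Hollow s →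
                          (∀ x y → d x y * s x y ≡ 0ℤ) →
                          (w : Vector ℤ n) → + 4 < sum w →
                          (∀ z → w z ≡ 0ℤ ⊎ Balanced d s (w ∖ z)) →
                          Balanced d s w
balanced-from-deletions {n} {d} {s} d-sym d-hollow s-sym s-hollow ds≡0 w 4<N deletions =
  balanced product≡0 cross≡0
  where
  N = sum w
  vanish : (F : Vector ℤ n → ℤ) → (∀ z → Balanced d s (w ∖ z) → F (w ∖ z) ≡ 0ℤ) →
           ⟨ w , (λ z → F (w ∖ z)) ⟩ ≡ 0ℤ
  vanish F F≡0 = ⟨,⟩-zero w λ z →
    [ (λ wz≡0 → cong (_* F (w ∖ z)) wz≡0) , (λ b → trans (cong (w z *_) (F≡0 z b)) (ℤ.*-zeroʳ (w z))) ]
      (deletions z)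
  cross≡0 : cross d s w ≡ 0ℤ
  cross≡0 = *-cancel-≢0 (c<N⇒N-c≢0 (ℤ.<-trans (+<+ (ℕ.n<1+n 3)) 4<N))
    (trans (sym (⟨,⟩-cross-∖ d-hollow s-hollow ds≡0 w)) (vanish (cross d s) (λ _ → Balanced.cross≡0)))
  product≡0 : total d w * total s w ≡ 0ℤ
  product≡0 = *-cancel-≢0 (c<N⇒N-c≢0 4<N) (begin
    (N - + 4) * XY                                     ≡⟨ ℤ.+-identityʳ _ ⟨
    (N - + 4) * XY + + 4 * 0ℤ                          ≡⟨ cong (λ t → (N - + 4) * XY + + 4 * t) cross≡0 ⟨
    (N - + 4) * XY + + 4 * cross d s w                 ≡⟨ ⟨,⟩-total*total-∖ d-sym d-hollow s-sym s-hollow w ⟨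
    ⟨ w , (λ z → total d (w ∖ z) * total s (w ∖ z)) ⟩
      ≡⟨ vanish (λ u → total d u * total s u) (λ _ → Balanced.product≡0) ⟩
    0ℤ                                                 ∎)
    where
    open ≡-Reasoning
    XY = total d w * total s w

-- Graphs as integer matrices

private variable
  v : ℕ

adjacency : Graph v → Matrix v
adjacency G x y = bit (adj G x y)

adjacency-symmetric : (G : Graph v) → Symmetric (adjacency G)
adjacency-symmetric G x y = cong bit (Graph.sym G x y)

adjacency-hollow : (G : Graph v) → Hollow (adjacency G)
adjacency-hollow G x = cong bit (irrefl G x)

adjacency-complement : (G : Graph v) (x y : Fin v) →
                       adjacency (complement G) x y ≡ 1ℤ - δ x y - adjacency G x y
adjacency-complement G x y with x ≟ y
... | yes refl = cong (λ a → 1ℤ - 1ℤ - a) (sym (adjacency-hollow G x))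
... | no _ with adj G x y
...   | true = refl
...   | false = refl

gap : Graph v → Graph v → Matrix v
gap G H x y = adjacency H x y - adjacency G x y

gap-symmetric : (G H : Graph v) → Symmetric (gap G H)
gap-symmetric G H x y = cong₂ _-_ (adjacency-symmetric H x y) (adjacency-symmetric G x y)

gap-hollow : (G H : Graph v) → Hollow (gap G H)
gap-hollow G H x = cong₂ _-_ (adjacency-hollow H x) (adjacency-hollow G x)

gap-orthogonal : (G H : Graph v) (x y : Fin v) → gap G H x y * gap H (complement G) x y ≡ 0ℤ
gap-orthogonal G H x y =
  trans (cong (λ c → gap G H x y * (c - adjacency H x y)) (adjacency-complement G x y)) orthogonal
  where
  orthogonal : gap G H x y * (1ℤ - δ x y - adjacency G x y - adjacency H x y) ≡ 0ℤ
  orthogonal with x ≟ y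
  ... | yes refl rewrite irrefl G x | irrefl H x = refl
  ... | no _ with adj G x y | adj H x y
  ...   | true  | true  = refl
  ...   | true  | false = refl
  ...   | false | true  = refl
  ...   | false | false = refl

gap-complementʳ : (G H : Graph v) (x y : Fin v) → gap G (complement H) x y ≡ gap H (complement G) x y
gap-complementʳ G H x y =
  trans (cong (_- adjacency G x y) (adjacency-complement H x y))
  (trans (exchange (δ x y) (adjacency G x y) (adjacency H x y))
         (sym (cong (_- adjacency H x y) (adjacency-complement G x y))))
  where
  exchange : ∀ e a b → 1ℤ - e - b - a ≡ 1ℤ - e - a - b
  exchange = solve-∀

gap-complement-complement : (G H : Graph v) (x y : Fin v) →
                            gap (complement H) (complement G) x y ≡ gap G H x y
gap-complement-complement G H x y =
  trans (cong₂ _-_ (adjacency-complement G x y) (adjacency-complement H x y))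
        (cancel (δ x y) (adjacency G x y) (adjacency H x y))
  where
  cancel : ∀ e a b → 1ℤ - e - a - (1ℤ - e - b) ≡ b - a
  cancel = solve-∀

deg-gap : (G H : Graph v) (w : Vector ℤ v) (x : Fin v) →
          deg (gap G H) w x ≡ deg (adjacency H) w x - deg (adjacency G) w x
deg-gap G H w x = ⟨,⟩-- w (adjacency H x) (adjacency G x)

total-gap : (G H : Graph v) (w : Vector ℤ v) →
            total (gap G H) w ≡ total (adjacency H) w - total (adjacency G) w
total-gap G H w = trans (⟨,⟩-cong w (deg-gap G H w)) (⟨,⟩-- w _ _)

deg-complement : (G : Graph v) (w : Vector ℤ v) (x : Fin v) →
                 deg (adjacency (complement G)) w x ≡ sum w - w x - deg (adjacency G) w x
deg-complement G w x = begin
  ⟨ w , adjacency (complement G) x ⟩                    ≡⟨ ⟨,⟩-cong w (adjacency-complement G x) ⟩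
  ⟨ w , (λ y → ((λ _ → 1ℤ) ∖ x) y - adjacency G x y) ⟩  ≡⟨ ⟨,⟩-- w _ _ ⟩
  ⟨ w , (λ _ → 1ℤ) ∖ x ⟩ - deg (adjacency G) w x         ≡⟨ cong (_- deg (adjacency G) w x) degree ⟩
  sum w - w x - deg (adjacency G) w x                   ∎
  where
  open ≡-Reasoning
  degree : ⟨ w , (λ _ → 1ℤ) ∖ x ⟩ ≡ sum w - w x
  degree = trans (⟨,⟩-comm w _) (trans (⟨∖,⟩ (λ _ → 1ℤ) x w) (cong (_- w x) (⟨1,⟩ w)))

indicator : Subset v → Vector ℤ v
indicator L x = bit (lookup L x)

⟨indicator,⟩-cong : (K : Subset v) {F F′ : Vector ℤ v} → (∀ x → x ∈ K → F x ≡ F′ x) →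
                    ⟨ indicator K , F ⟩ ≡ ⟨ indicator K , F′ ⟩
⟨indicator,⟩-cong {v} K {F} {F′} F≗F′ = sum-cong-≗ {v} pointwise
  where
  pointwise : ∀ x → indicator K x * F x ≡ indicator K x * F′ x
  pointwise x with lookup K x in x∈?K
  ... | outside = refl
  ... | inside  = cong (1ℤ *_) (F≗F′ x (lookup⇒[]= x K x∈?K))

sum-indicator : (L : Subset v) → sum (indicator L) ≡ + ∣ L ∣
sum-indicator [] = refl
sum-indicator (inside ∷ L) = cong (_+_ 1ℤ) (sum-indicator L)
sum-indicator (outside ∷ L) = trans (ℤ.+-identityˡ _) (sum-indicator L)

∣p∣≡1+∣p[x]≔outside∣ : {L : Subset v} {z : Fin v} → z ∈ L → ∣ L ∣ ≡ suc ∣ L [ z ]≔ outside ∣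
∣p∣≡1+∣p[x]≔outside∣ here = refl
∣p∣≡1+∣p[x]≔outside∣ {L = inside ∷ L} (there z∈L) = cong suc (∣p∣≡1+∣p[x]≔outside∣ z∈L)
∣p∣≡1+∣p[x]≔outside∣ {L = outside ∷ L} (there z∈L) = ∣p∣≡1+∣p[x]≔outside∣ z∈L

indicator-[]≔outside : (L : Subset v) {z : Fin v} → z ∈ L →
                       ∀ y → indicator (L [ z ]≔ outside) y ≡ (indicator L ∖ z) y
indicator-[]≔outside L {z} z∈L y with z ≟ y
... | yes refl rewrite lookup∘update z L outside | []=⇒lookup z∈L = refl
... | no z≢y rewrite lookup∘update′ (z≢y ∘ sym) L outside = sym (ℤ.+-identityʳ _)

BalancedOn : Graph v → Graph v → Subset v → Set
BalancedOn G H L = Balanced (gap G H) (gap H (complement G)) (indicator L)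

balancedOn-complement : (G H : Graph v) (L : Subset v) →
                        BalancedOn G (complement H) L → BalancedOn G H L
balancedOn-complement G H L b =
  Balanced-swap (Balanced-cong (gap-complementʳ G H) (gap-complement-complement G H) (λ _ → refl) b)

balancedOn-from-deletions : (G H : Graph v) (L : Subset v) → 5 ≤ ∣ L ∣ →
                            (∀ z → z ∈ L → BalancedOn G H (L [ z ]≔ outside)) → BalancedOn G H L
balancedOn-from-deletions G H L 5≤∣L∣ smaller =
  balanced-from-deletions (gap-symmetric G H) (gap-hollow G H)
                          (gap-symmetric H (complement G)) (gap-hollow H (complement G))
                          (gap-orthogonal G H) (indicator L)
                          (subst (+ 4 <_) (sym (sum-indicator L)) (+<+ 5≤∣L∣)) deletion
  where
  deletion : ∀ z → indicator L z ≡ 0ℤ ⊎ Balanced (gap G H) (gap H (complement G)) (indicator L ∖ z)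
  deletion z with lookup L z in z∈?L
  ... | outside = inj₁ refl
  ... | inside  = inj₂ (Balanced-cong (λ _ _ → refl) (λ _ _ → refl)
                                      (indicator-[]≔outside L z∈L) (smaller z z∈L))
    where z∈L = lookup⇒[]= z L z∈?L

-- Counting edges

count-filter : {A : Set} {P : Pred A 0ℓ} (P? : Decidable P) (f : Fin n → A) →
               + length (filter P? (tabulate f)) ≡ sum (λ i → bit (does (P? (f i))))
count-filter {zero} P? f = refl
count-filter {suc n} P? f with does (P? (f zero))
... | true  = cong (_+_ 1ℤ) (count-filter P? (f ∘ suc))
... | false = trans (count-filter P? (f ∘ suc)) (sym (ℤ.+-identityˡ _))

count-filter-cartesianProduct :
  {A B : Set} {P : Pred (A × B) 0ℓ} (P? : Decidable P) {m : ℕ} (f : Fin m → A) (g : Fin n → B) →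
  + length (filter P? (cartesianProduct (tabulate f) (tabulate g)))
    ≡ sum (λ i → sum (λ j → bit (does (P? (f i , g j)))))
count-filter-cartesianProduct P? {zero} f g = refl
count-filter-cartesianProduct P? {suc m} f g = begin
  + length (filter P? (row ++ rest))                      ≡⟨ cong (λ xs → + length xs) (filter-++ P? row rest) ⟩
  + length (filter P? row ++ filter P? rest)              ≡⟨ cong +_ (length-++ (filter P? row)) ⟩
  + (length (filter P? row) ℕ.+ length (filter P? rest))  ≡⟨ ℤ.pos-+ (length (filter P? row)) _ ⟩
  + length (filter P? row) + + length (filter P? rest)
    ≡⟨ cong₂ _+_ (trans (cong (λ xs → + length (filter P? xs)) (map-tabulate g (f zero ,_)))
                        (count-filter P? (λ j → f zero , g j)))
                 (count-filter-cartesianProduct P? (f ∘ suc) g) ⟩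
  sum (λ j → bit (does (P? (f zero , g j))))
    + sum (λ i → sum (λ j → bit (does (P? (f (suc i) , g j)))))  ∎
  where
  open ≡-Reasoning
  row  = map (f zero ,_) (tabulate g)
  rest = cartesianProduct (tabulate (f ∘ suc)) (tabulate g)

bit-∧ : ∀ a b → bit (a ∧ b) ≡ bit a * bit b
bit-∧ true  b = sym (ℤ.*-identityˡ (bit b))
bit-∧ false b = refl

does-∈? : (x : Fin v) (L : Subset v) → does (x ∈? L) ≡ lookup L x
does-∈? zero    (inside  ∷ L) = refl
does-∈? zero    (outside ∷ L) = refl
does-∈? (suc x) (_ ∷ L)       = does-∈? x L

lt : Fin n → Fin n → ℤ
lt x y = bit (does (x <ᶠ? y))

edges-as-sum : (G : Graph v) (L : Subset v) →
               + edges G L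
                 ≡ sum (λ x → sum (λ y → lt x y * (indicator L x * (indicator L y * adjacency G x y))))
edges-as-sum {v} G L =
  trans (count-filter-cartesianProduct _ {v} id id) (sum-cong-≗ {v} λ x → sum-cong-≗ {v} (summand x))
  where
  summand : ∀ x y → bit (does (x <ᶠ? y) ∧ (does (x ∈? L) ∧ (does (y ∈? L) ∧ adj G x y)))
                    ≡ lt x y * (indicator L x * (indicator L y * adjacency G x y))
  summand x y rewrite does-∈? x L | does-∈? y L =
    trans (bit-∧ (does (x <ᶠ? y)) _)
          (cong (lt x y *_) (trans (bit-∧ (lookup L x) _) (cong (indicator L x *_) (bit-∧ (lookup L y) _))))

lt-+-lt : (x y : Fin n) → lt x y + lt y x ≡ 1ℤ - δ x y
lt-+-lt x y with <-cmp x y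
... | tri< x<y x≢y y≮x
  rewrite dec-true (x <ᶠ? y) x<y | dec-false (y <ᶠ? x) y≮x | dec-false (x ≟ y) x≢y = refl
... | tri≈ x≮y refl _
  rewrite dec-false (x <ᶠ? x) x≮y | dec-true (x ≟ x) refl = refl
... | tri> x≮y x≢y y<x
  rewrite dec-false (x <ᶠ? y) x≮y | dec-true (y <ᶠ? x) y<x | dec-false (x ≟ y) x≢y = refl

∑<-double : {m : Matrix n} → Symmetric m → Hollow m →
            + 2 * sum (λ x → sum (λ y → lt x y * m x y)) ≡ sum (λ x → sum (m x))
∑<-double {n} {m} m-sym m-hollow = begin
  + 2 * S                                                    ≡⟨ double S ⟩
  S + S                                                      ≡⟨ cong (_+_ S) flipped ⟨
  S + sum (λ x → sum (λ y → lt y x * m x y))                 ≡⟨ ∑-distrib-+ {n} _ _ ⟨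
  sum (λ x → sum (λ y → lt x y * m x y) + sum (λ y → lt y x * m x y))
    ≡⟨ sum-cong-≗ {n} (λ x → ∑-distrib-+ {n} _ _) ⟨
  sum (λ x → sum (λ y → lt x y * m x y + lt y x * m x y))
    ≡⟨ sum-cong-≗ {n} (λ x → sum-cong-≗ {n} λ y → trans (sym (ℤ.*-distribʳ-+ (m x y) (lt x y) (lt y x)))
                                                        (cong (_* m x y) (lt-+-lt x y))) ⟩
  sum (λ x → ⟨ (λ _ → 1ℤ) ∖ x , m x ⟩)                       ≡⟨ sum-cong-≗ {n} off-diagonal ⟩
  sum (λ x → sum (m x))                                      ∎
  where
  open ≡-Reasoning
  S = sum (λ x → sum (λ y → lt x y * m x y))
  double : ∀ a → + 2 * a ≡ a + a
  double = solve-∀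
  flipped : sum (λ x → sum (λ y → lt y x * m x y)) ≡ S
  flipped = trans (∑-comm {n} {n} _) (sum-cong-≗ {n} λ x → sum-cong-≗ {n} λ y → cong (lt x y *_) (m-sym y x))
  off-diagonal : ∀ x → ⟨ (λ _ → 1ℤ) ∖ x , m x ⟩ ≡ sum (m x)
  off-diagonal x = begin
    ⟨ (λ _ → 1ℤ) ∖ x , m x ⟩        ≡⟨ ⟨∖,⟩ (λ _ → 1ℤ) x (m x) ⟩
    ⟨ (λ _ → 1ℤ) , m x ⟩ - m x x    ≡⟨ cong (_-_ ⟨ (λ _ → 1ℤ) , m x ⟩) (m-hollow x) ⟩
    ⟨ (λ _ → 1ℤ) , m x ⟩ - 0ℤ       ≡⟨ ℤ.+-identityʳ _ ⟩
    ⟨ (λ _ → 1ℤ) , m x ⟩            ≡⟨ ⟨1,⟩ (m x) ⟩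
    sum (m x)                       ∎

total-adjacency : (G : Graph v) (L : Subset v) → total (adjacency G) (indicator L) ≡ + 2 * + edges G L
total-adjacency {v} G L = sym (begin
  + 2 * + edges G L                       ≡⟨ cong (+ 2 *_) (edges-as-sum G L) ⟩
  + 2 * sum (λ x → sum (λ y → lt x y * m x y))   ≡⟨ ∑<-double m-sym m-hollow ⟩
  sum (λ x → sum (m x))                   ≡⟨ sum-cong-≗ {v} (λ x → sym (*-distribˡ-sum {v} (χ x) _)) ⟩
  total (adjacency G) χ                   ∎)
  where
  open ≡-Reasoning
  χ = indicator L
  m : Matrix v
  m x y = χ x * (χ y * adjacency G x y)
  m-sym : Symmetric m
  m-sym x y = trans (cong (λ a → χ x * (χ y * a)) (adjacency-symmetric G x y)) (x∙yz≈y∙xz (χ x) (χ y) _)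
  m-hollow : Hollow m
  m-hollow x = trans (cong (λ a → χ x * (χ x * a)) (adjacency-hollow G x))
                     (trans (cong (χ x *_) (ℤ.*-zeroʳ (χ x))) (ℤ.*-zeroʳ (χ x)))

total-gap≡0⇒edges≡ : (G H : Graph v) (L : Subset v) →
                     total (gap G H) (indicator L) ≡ 0ℤ → edges H L ≡ edges G L
total-gap≡0⇒edges≡ G H L total≡0 = ℤ.+-injective (ℤ.*-cancelˡ-≡ (+ 2) _ _ (begin
  + 2 * + edges H L                   ≡⟨ total-adjacency H L ⟨
  total (adjacency H) (indicator L)
    ≡⟨ ℤ.i-j≡0⇒i≡j _ _ (trans (sym (total-gap G H (indicator L))) total≡0) ⟩
  total (adjacency G) (indicator L)   ≡⟨ total-adjacency G L ⟩
  + 2 * + edges G L                   ∎))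
  where open ≡-Reasoning

balancedOn⇒edges≡ : (G H : Graph v) (L : Subset v) → BalancedOn G H L →
                    (edges H L ≡ edges G L) ⊎ (edges H L ≡ edges (complement G) L)
balancedOn⇒edges≡ G H L b =
  Sum.map (total-gap≡0⇒edges≡ G H L) (sym ∘ total-gap≡0⇒edges≡ H (complement G) L)
          (ℤ.i*j≡0⇒i≡0∨j≡0 _ (Balanced.product≡0 b))

-- Relabelling along an isomorphism

module _ {K : Subset v} where

  extend : (Elem K → Elem K) → Fin v → Fin v
  extend f x with x ∈? K
  ... | yes x∈K = proj₁ (f (x , x∈K))
  ... | no _    = x

  extend-∈ : (f : Elem K → Elem K) {x : Fin v} (x∈K : x ∈ K) → extend f x ≡ proj₁ (f (x , x∈K))
  extend-∈ f {x} x∈K with x ∈? K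
  ... | yes x∈K′ = cong (λ p → proj₁ (f (x , p))) ([]=-irrelevant x∈K′ x∈K)
  ... | no  x∉K  = ⊥-elim (x∉K x∈K)

  extend-∉ : (f : Elem K → Elem K) {x : Fin v} → x ∉ K → extend f x ≡ x
  extend-∉ f {x} x∉K with x ∈? K
  ... | yes x∈K = ⊥-elim (x∉K x∈K)
  ... | no  _   = refl

  extend-inverse : (f g : Elem K → Elem K) → (∀ y → f (g y) ≡ y) → ∀ x → extend f (extend g x) ≡ x
  extend-inverse f g fg x with x ∈? K
  ... | yes x∈K = trans (extend-∈ f (proj₂ (g (x , x∈K)))) (cong proj₁ (fg (x , x∈K)))
  ... | no  x∉K = extend-∉ f x∉K

  indicator-extend : (f : Elem K → Elem K) (x : Fin v) → indicator K (extend f x) ≡ indicator K x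
  indicator-extend f x with x ∈? K
  ... | yes x∈K rewrite []=⇒lookup (proj₂ (f (x , x∈K))) | []=⇒lookup x∈K = refl
  ... | no  _   = refl

  relabelling : Elem K ⤖ Elem K → Permutation′ v
  relabelling σ = permutation (extend to) (extend from)
                              (extend-inverse to from strictlyInverseˡ)
                              (extend-inverse from to strictlyInverseʳ)
    where open Inverse (⤖⇒↔ σ)

module _ {K : Subset v} {G H : Graph v} (iso : IsoOn K G H) where

  private
    σ = proj₁ iso
    σ-preserves = proj₂ iso
    χ = indicator K
    ρ = extend (Bijection.to σ)

    indicator-ρ : ∀ x → indicator K (relabelling σ ⟨$⟩ʳ x) ≡ indicator K x
    indicator-ρ = indicator-extend (Bijection.to σ)

    deg-relabelling : ∀ x → x ∈ K → deg (adjacency H) χ (ρ x) ≡ deg (adjacency G) χ x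
    deg-relabelling x x∈K =
      trans (⟨,⟩-permute χ (adjacency H (ρ x)) (relabelling σ) indicator-ρ)
            (⟨indicator,⟩-cong K λ y y∈K → begin
              adjacency H (ρ x) (ρ y)
                ≡⟨ cong₂ (adjacency H) (extend-∈ (Bijection.to σ) x∈K) (extend-∈ (Bijection.to σ) y∈K) ⟩
              bit (adj H (proj₁ (Bijection.to σ (x , x∈K))) (proj₁ (Bijection.to σ (y , y∈K))))
                ≡⟨ cong bit (σ-preserves (x , x∈K) (y , y∈K)) ⟨
              adjacency G x y ∎)
      where open ≡-Reasoning

  ⟨indicator,⟩-relabelling : (φ : ℤ → ℤ) →
    ⟨ χ , φ ∘ deg (adjacency H) χ ⟩ ≡ ⟨ χ , φ ∘ deg (adjacency G) χ ⟩
  ⟨indicator,⟩-relabelling φ =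
    trans (⟨,⟩-permute χ (φ ∘ deg (adjacency H) χ) (relabelling σ) indicator-ρ)
          (⟨indicator,⟩-cong K λ x x∈K → cong φ (deg-relabelling x x∈K))

  iso⇒balancedOn : BalancedOn G H K
  iso⇒balancedOn = balanced product≡0 cross≡0
    where
    open ≡-Reasoning
    a = deg (adjacency G) χ
    b = deg (adjacency H) χ
    N = sum χ
    ψ : ℤ → ℤ
    ψ u = (N - 1ℤ) * u - u * u
    difference-vanishes : (φ : ℤ → ℤ) → ⟨ χ , (λ x → φ (b x) - φ (a x)) ⟩ ≡ 0ℤ
    difference-vanishes φ = begin
      ⟨ χ , (λ x → φ (b x) - φ (a x)) ⟩   ≡⟨ ⟨,⟩-- χ (φ ∘ b) (φ ∘ a) ⟩
      ⟨ χ , φ ∘ b ⟩ - ⟨ χ , φ ∘ a ⟩       ≡⟨ cong (_- ⟨ χ , φ ∘ a ⟩) (⟨indicator,⟩-relabelling φ) ⟩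
      ⟨ χ , φ ∘ a ⟩ - ⟨ χ , φ ∘ a ⟩       ≡⟨ ℤ.+-inverseʳ ⟨ χ , φ ∘ a ⟩ ⟩
      0ℤ                                  ∎
    total≡0 : total (gap G H) χ ≡ 0ℤ
    total≡0 = trans (⟨,⟩-cong χ (deg-gap G H χ)) (difference-vanishes id)
    product≡0 : total (gap G H) χ * total (gap H (complement G)) χ ≡ 0ℤ
    product≡0 = cong (_* total (gap H (complement G)) χ) total≡0
    cross≡0 : cross (gap G H) (gap H (complement G)) χ ≡ 0ℤ
    cross≡0 = begin
      ⟨ χ , (λ x → deg (gap G H) χ x * deg (gap H (complement G)) χ x) ⟩
        ≡⟨ ⟨,⟩-cong χ (λ x → cong₂ _*_ (deg-gap G H χ x)
                                      (trans (deg-gap H (complement G) χ x)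
                                             (cong (_- b x) (deg-complement G χ x)))) ⟩
      ⟨ χ , (λ x → (b x - a x) * (N - χ x - a x - b x)) ⟩
        ≡⟨ ⟨indicator,⟩-cong K (λ x x∈K → cong (λ c → (b x - a x) * (N - c - a x - b x))
                                                (cong bit ([]=⇒lookup x∈K))) ⟩
      ⟨ χ , (λ x → (b x - a x) * (N - 1ℤ - a x - b x)) ⟩
        ≡⟨ ⟨,⟩-cong χ (λ x → split N (a x) (b x)) ⟩
      ⟨ χ , (λ x → ψ (b x) - ψ (a x)) ⟩
        ≡⟨ difference-vanishes ψ ⟩
      0ℤ ∎
      where
      split : ∀ N a b → (b - a) * (N - 1ℤ - a - b) ≡ ((N - 1ℤ) * b - b * b) - ((N - 1ℤ) * a - a * a)
      split = solve-∀

isoUpToComp⇒balancedOn : {K : Subset v} {G H : Graph v} → IsoUpToCompOn K G H → BalancedOn G H K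
isoUpToComp⇒balancedOn {K = K} {G} {H} =
  [ iso⇒balancedOn {K = K} {G} {H} , balancedOn-complement G H K ∘ iso⇒balancedOn {K = K} {G} {complement H} ]

hypomorphic⇒balancedOn : {G H : Graph v} {k : ℕ} → 4 ≤ k → HypomorphicUpToComp k G H →
                         (L : Subset v) → k ≤ ∣ L ∣ → BalancedOn G H L
hypomorphic⇒balancedOn {G = G} {H} {k} 4≤k hypomorphic L k≤∣L∣ =
  go (∣ L ∣ ℕ.∸ k) L (sym (ℕ.m+[n∸m]≡n k≤∣L∣))
  where
  go : ∀ j L → ∣ L ∣ ≡ k ℕ.+ j → BalancedOn G H L
  go zero    L ∣L∣≡k   = isoUpToComp⇒balancedOn (hypomorphic L (trans ∣L∣≡k (ℕ.+-identityʳ k)))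
  go (suc j) L ∣L∣≡k+j = balancedOn-from-deletions G H L 5≤∣L∣ λ z z∈L →
    go j (L [ z ]≔ outside) (ℕ.suc-injective (trans (sym (∣p∣≡1+∣p[x]≔outside∣ z∈L))
                                                    (trans ∣L∣≡k+j (ℕ.+-suc k j))))
    where
    5≤∣L∣ : 5 ≤ ∣ L ∣
    5≤∣L∣ = subst (5 ≤_) (sym ∣L∣≡k+j) (ℕ.+-mono-≤ 4≤k (ℕ.s≤s ℕ.z≤n))

proposition3p6 : (v : ℕ) (G G′ : Graph v) (k : ℕ) → 4 ≤ k → k ≤ v →
    HypomorphicUpToComp k G G′ →
    (l : ℕ) → k ≤ l → l ≤ v → (L : Subset v) → ∣ L ∣ ≡ l →
    (edges G′ L ≡ edges G L) ⊎ (edges G′ L ≡ edges (complement G) L)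
proposition3p6 v G G′ k 4≤k _ hypomorphic l k≤l _ L ∣L∣≡l =
  balancedOn⇒edges≡ G G′ L (hypomorphic⇒balancedOn 4≤k hypomorphic L (subst (k ≤_) (sym ∣L∣≡l) k≤l))
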